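{- Let $q$ be a power of $2$ and $a,b\in\mathbb{N}$. Then the monomial $t^{2q^2}[a,b]$ is either equal to or precedes $[a+q,b]$, and the monomial $t^{4q^2}[a,b]$ is either equal to or precedes $[a,b+q]$.
   Context: $\mathbb{N}=\{0,1,2,\dots\}$. Let $g:\mathbb{N}\to\mathbb{N}$ be defined by $g(0)=0$, $g(2n)=4g(n)$, $g(2n+1)=g(2n)+1$. For $a,b\in\mathbb{N}$, $[a,b]$ denotes $t^{1+2g(a)+4g(b)}\in\mathbb{Z}/2[t]$; every $t^k$ with $k$ odd positive is uniquely of this form. Say $[c,d]$ precedes $[a,b]$ if $c+d<a+b$, or $c+d=a+b$ and $d<b$. -}

module Defs where

open import Data.Nat using (ℕ; zero; suc; _+_; _*_; _<_; _/_; _%_)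
open import Data.Product using (_×_)
open import Data.Sum using (_⊎_)
open import Relation.Binary.PropositionalEquality using (_≡_; refl)

-- g with fuel: gF f n computes g n whenever f ≥ (number of binary digits of n);
-- gF f n = 4 * gF f' (n / 2) + n % 2 encodes g(2m) = 4 g(m), g(2m+1) = 4 g(m) + 1.
gF : ℕ → ℕ → ℕ
gF zero    n = 0
gF (suc f) n = 4 * gF f (n / 2) + n % 2

g : ℕ → ℕ
g n = gF n n

private
  g-test₁ : g 0 ≡ 0
  g-test₁ = refl
  g-test₂ : g 5 ≡ 17
  g-test₂ = refl
  g-test₃ : g 6 ≡ 20
  g-test₃ = refl

-- exponent of the monomial [a,b] = t^(1 + 2 g(a) + 4 g(b)) in ℤ/2[t]
-- (a monomial t^k is identified with its exponent k)
bracketExp : ℕ → ℕ → ℕ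
bracketExp a b = 1 + 2 * g a + 4 * g b

Precedes : ℕ → ℕ → ℕ → ℕ → Set
Precedes c d a b = (c + d < a + b) ⊎ ((c + d ≡ a + b) × (d < b))

EqOrPrecedes : ℕ → ℕ → ℕ → ℕ → Set
EqOrPrecedes c d a b = (bracketExp c d ≡ bracketExp a b) ⊎ Precedes c d a b

-- Write [a,b] = t^(1 + 2 n) with n = g a + 2 g b: n interleaves the binary digits of a (even
-- positions) and b (odd positions), and (a,b) ↦ n is a bijection ℕ × ℕ → ℕ.  Multiplying by
-- t^(2 q²) resp. t^(4 q²) adds 4^k resp. 2·4^k to n, i.e. adds 1 at the k-th binary digit of a
-- resp. b.  The k lowest digit pairs are untouched, so stripping them one at a time reduces both
-- claims to q = 1, i.e. to adding 1 resp. 2 to n, which a case analysis on the lowest bits of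
-- a and b settles, recursing through the carry when both are 1.
module Submission where

open import Defs
open import Data.Nat using (ℕ; zero; suc; _+_; _*_; _^_; _≤_; _<_; z≤n; s≤s; _/_; _%_)
open import Data.Nat.Properties
open import Data.Nat.DivMod using (m/n<m; m*n/n≡m; /-congˡ; +-distrib-/-∣ʳ; %-remove-+ʳ)
open import Data.Nat.Divisibility using (m∣m*n)
open import Data.Nat.Induction using (<-wellFounded)
open import Data.Nat.Tactic.RingSolver using (solve-∀)
open import Data.Product using (_×_; ∃₂; _,_)
open import Data.Sum using (inj₁; inj₂)
open import Data.Empty using (⊥-elim)
open import Induction.WellFounded using (Acc; acc)
open import Relation.Binary.PropositionalEquality
open ≡-Reasoning

gF-zero : ∀ f → gF f 0 ≡ 0
gF-zero zero    = refl
gF-zero (suc f) = cong (λ x → 4 * x + 0) (gF-zero f)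

half-≤ : ∀ {n f} → n ≤ suc f → n / 2 ≤ f
half-≤ {zero}  _   = z≤n
half-≤ {suc n} n≤f = ≤-pred (≤-trans (m/n<m (suc n) 2 (s≤s (s≤s z≤n))) n≤f)

gF-stable : ∀ {f f' n} → n ≤ f → n ≤ f' → gF f n ≡ gF f' n
gF-stable {zero}  {f'}     z≤n _ = sym (gF-zero f')
gF-stable {suc f} {zero}   z≤n _ = gF-zero (suc f)
gF-stable {suc f} {suc f'} {n} n≤f n≤f' =
  cong (λ x → 4 * x + n % 2) (gF-stable (half-≤ n≤f) (half-≤ n≤f'))

g-unfold : ∀ n → g n ≡ 4 * g (n / 2) + n % 2
g-unfold zero    = refl
g-unfold (suc n) =
  cong (λ x → 4 * x + suc n % 2) (gF-stable {n} {suc n / 2} (half-≤ ≤-refl) ≤-refl)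

data Bit : Set where
  O I : Bit

⟦_⟧ : Bit → ℕ
⟦ O ⟧ = 0
⟦ I ⟧ = 1

split-bit : ∀ n → ∃₂ λ β m → n ≡ ⟦ β ⟧ + 2 * m
split-bit zero = O , 0 , refl
split-bit (suc n) with split-bit n
... | O , m , refl = I , m , refl
... | I , m , refl = O , suc m , sym (*-suc 2 m)

bit-injective : ∀ β β' x y → ⟦ β ⟧ + 2 * x ≡ ⟦ β' ⟧ + 2 * y → β ≡ β' × x ≡ y
bit-injective O O x y eq = refl , *-cancelˡ-≡ x y 2 eq
bit-injective O I x y eq = ⊥-elim (even≢odd x y eq)
bit-injective I O x y eq = ⊥-elim (even≢odd y x (sym eq))
bit-injective I I x y eq = refl , *-cancelˡ-≡ x y 2 (suc-injective eq)

bits-injective : ∀ γ δ γ' δ' x y →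
  ⟦ γ ⟧ + 2 * (⟦ δ ⟧ + 2 * x) ≡ ⟦ γ' ⟧ + 2 * (⟦ δ' ⟧ + 2 * y) → γ ≡ γ' × δ ≡ δ' × x ≡ y
bits-injective γ δ γ' δ' x y eq with bit-injective γ γ' _ _ eq
... | refl , eq′ with bit-injective δ δ' x y eq′
... | refl , eq″ = refl , refl , eq″

double/2 : ∀ m → 2 * m / 2 ≡ m
double/2 m = trans (/-congˡ (*-comm 2 m)) (m*n/n≡m m 2)

bit/2 : ∀ β m → (⟦ β ⟧ + 2 * m) / 2 ≡ m
bit/2 O m = double/2 m
bit/2 I m = trans (+-distrib-/-∣ʳ 1 (m∣m*n {2} m)) (double/2 m)

bit%2 : ∀ β m → (⟦ β ⟧ + 2 * m) % 2 ≡ ⟦ β ⟧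
bit%2 O m = %-remove-+ʳ 0 (m∣m*n {2} m)
bit%2 I m = %-remove-+ʳ 1 (m∣m*n {2} m)

bitHalf-≤ : ∀ β m {f} → ⟦ β ⟧ + 2 * m ≤ suc f → m ≤ f
bitHalf-≤ β m le = subst (_≤ _) (bit/2 β m) (half-≤ le)

g-bit : ∀ β m → g (⟦ β ⟧ + 2 * m) ≡ ⟦ β ⟧ + 4 * g m
g-bit β m = begin
  g (⟦ β ⟧ + 2 * m)                                    ≡⟨ g-unfold (⟦ β ⟧ + 2 * m) ⟩
  4 * g ((⟦ β ⟧ + 2 * m) / 2) + (⟦ β ⟧ + 2 * m) % 2    ≡⟨ cong₂ (λ x y → 4 * g x + y) (bit/2 β m) (bit%2 β m) ⟩
  4 * g m + ⟦ β ⟧                                      ≡⟨ +-comm (4 * g m) ⟦ β ⟧ ⟩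
  ⟦ β ⟧ + 4 * g m                                      ∎

interleave : ℕ → ℕ → ℕ
interleave c d = g c + 2 * g d

interleave-bit : ∀ β c d → interleave (⟦ β ⟧ + 2 * c) d ≡ ⟦ β ⟧ + 2 * interleave d c
interleave-bit β c d = begin
  g (⟦ β ⟧ + 2 * c) + 2 * g d    ≡⟨ cong (_+ 2 * g d) (g-bit β c) ⟩
  ⟦ β ⟧ + 4 * g c + 2 * g d      ≡⟨ shuffle ⟦ β ⟧ (g c) (g d) ⟩
  ⟦ β ⟧ + 2 * (g d + 2 * g c)    ∎
  where
  shuffle : ∀ x y z → x + 4 * y + 2 * z ≡ x + 2 * (z + 2 * y)
  shuffle = solve-∀

interleave-bits : ∀ γ δ c d →
  interleave (⟦ γ ⟧ + 2 * c) (⟦ δ ⟧ + 2 * d) ≡ ⟦ γ ⟧ + 2 * (⟦ δ ⟧ + 2 * interleave c d)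
interleave-bits γ δ c d =
  trans (interleave-bit γ c (⟦ δ ⟧ + 2 * d)) (cong (λ x → ⟦ γ ⟧ + 2 * x) (interleave-bit δ d c))

interleave-injective-≤ : ∀ f {c d c' d'} → c ≤ f → d ≤ f → c' ≤ f → d' ≤ f →
  interleave c d ≡ interleave c' d' → c ≡ c' × d ≡ d'
interleave-injective-≤ zero z≤n z≤n z≤n z≤n _ = refl , refl
interleave-injective-≤ (suc f) {c} {d} {c'} {d'} c≤f d≤f c'≤f d'≤f eq
  with split-bit c | split-bit d | split-bit c' | split-bit d'
... | γ , c₁ , refl | δ , d₁ , refl | γ' , c₁' , refl | δ' , d₁' , refl
  with bits-injective γ δ γ' δ' (interleave c₁ d₁) (interleave c₁' d₁')
         (trans (sym (interleave-bits γ δ c₁ d₁)) (trans eq (interleave-bits γ' δ' c₁' d₁')))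
... | refl , refl , eq₁
  with interleave-injective-≤ f {c₁} {d₁} {c₁'} {d₁'}
         (bitHalf-≤ γ c₁ c≤f) (bitHalf-≤ δ d₁ d≤f) (bitHalf-≤ γ c₁' c'≤f) (bitHalf-≤ δ d₁' d'≤f) eq₁
... | refl , refl = refl , refl

interleave-injective : ∀ {c d c' d'} → interleave c d ≡ interleave c' d' → c ≡ c' × d ≡ d'
interleave-injective {c} {d} {c'} {d'} = interleave-injective-≤ (c + d + (c' + d'))
  (≤-trans (m≤m+n c d) (m≤m+n (c + d) (c' + d')))
  (≤-trans (m≤n+m d c) (m≤m+n (c + d) (c' + d')))
  (≤-trans (m≤m+n c' d') (m≤n+m (c' + d') (c + d)))
  (≤-trans (m≤n+m d' c') (m≤n+m (c' + d') (c + d)))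

interleave-surjective-≤ : ∀ f {n} → n ≤ f → ∃₂ λ c d → interleave c d ≡ n
interleave-surjective-≤ zero    z≤n = 0 , 0 , refl
interleave-surjective-≤ (suc f) {n} n≤f with split-bit n
... | β , m , refl with interleave-surjective-≤ f (bitHalf-≤ β m n≤f)
... | d , c , eq = ⟦ β ⟧ + 2 * c , d , trans (interleave-bit β c d) (cong (λ x → ⟦ β ⟧ + 2 * x) eq)

interleave-surjective : ∀ n → ∃₂ λ c d → interleave c d ≡ n
interleave-surjective n = interleave-surjective-≤ n ≤-refl

data SameOrPrecedes : ℕ → ℕ → ℕ → ℕ → Set where
  same     : ∀ {a b} → SameOrPrecedes a b a b
  precedes : ∀ {c d a b} → Precedes c d a b → SameOrPrecedes c d a b

sameOrPrecedes-suc : ∀ {c d x y} → SameOrPrecedes c d x y → Precedes c d x (suc y)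
sameOrPrecedes-suc {x = x} {y} same                       = inj₁ (+-monoʳ-< x (n<1+n y))
sameOrPrecedes-suc {x = x} {y} (precedes (inj₁ s<))       = inj₁ (<-trans s< (+-monoʳ-< x (n<1+n y)))
sameOrPrecedes-suc {x = x} {y} (precedes (inj₂ (s≡ , _))) =
  inj₁ (≤-<-trans (≤-reflexive s≡) (+-monoʳ-< x (n<1+n y)))

sameOrPrecedes-diagonal : ∀ {c d x y} → SameOrPrecedes c d (suc x) y → Precedes c d x (suc y)
sameOrPrecedes-diagonal {x = x} {y} same                        = inj₂ (sym (+-suc x y) , n<1+n y)
sameOrPrecedes-diagonal {x = x} {y} (precedes (inj₁ s<))        =
  inj₁ (<-≤-trans s< (≤-reflexive (sym (+-suc x y))))
sameOrPrecedes-diagonal {x = x} {y} (precedes (inj₂ (s≡ , d<))) =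
  inj₂ (trans s≡ (sym (+-suc x y)) , m<n⇒m<1+n d<)

bits-sum : ∀ x y u v → x + 2 * u + (y + 2 * v) ≡ x + y + 2 * (u + v)
bits-sum = solve-∀

precedes-double : ∀ γ δ {c d a b} → Precedes c d a b →
  Precedes (⟦ γ ⟧ + 2 * c) (⟦ δ ⟧ + 2 * d) (⟦ γ ⟧ + 2 * a) (⟦ δ ⟧ + 2 * b)
precedes-double γ δ {c} {d} {a} {b} (inj₁ s<) =
  inj₁ (subst₂ _<_ (sym (bits-sum ⟦ γ ⟧ ⟦ δ ⟧ c d)) (sym (bits-sum ⟦ γ ⟧ ⟦ δ ⟧ a b))
                   (+-monoʳ-< (⟦ γ ⟧ + ⟦ δ ⟧) (*-monoʳ-< 2 {c + d} {a + b} s<)))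
precedes-double γ δ {c} {d} {a} {b} (inj₂ (s≡ , d<)) =
  inj₂ ( trans (bits-sum ⟦ γ ⟧ ⟦ δ ⟧ c d)
           (trans (cong (λ s → ⟦ γ ⟧ + ⟦ δ ⟧ + 2 * s) s≡) (sym (bits-sum ⟦ γ ⟧ ⟦ δ ⟧ a b)))
       , +-monoʳ-< ⟦ δ ⟧ (*-monoʳ-< 2 {d} {b} d<))

sameOrPrecedes-double : ∀ γ δ {c d a b} → SameOrPrecedes c d a b →
  SameOrPrecedes (⟦ γ ⟧ + 2 * c) (⟦ δ ⟧ + 2 * d) (⟦ γ ⟧ + 2 * a) (⟦ δ ⟧ + 2 * b)
sameOrPrecedes-double γ δ same         = same
sameOrPrecedes-double γ δ (precedes p) = precedes (precedes-double γ δ p)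

interleave-suc-acc : ∀ {a b c d} → Acc _<_ a →
  interleave c d ≡ suc (interleave a b) → SameOrPrecedes c d (suc a) b
interleave-suc-acc {a} {b} {c} {d} (acc rec) eq with split-bit a | split-bit b
... | O , a₁ , refl | β , b₁ , refl
  with interleave-injective {c} {d} {suc (2 * a₁)} {⟦ β ⟧ + 2 * b₁} (begin
    interleave c d                               ≡⟨ eq ⟩
    suc (interleave (2 * a₁) (⟦ β ⟧ + 2 * b₁))   ≡⟨ cong suc (interleave-bits O β a₁ b₁) ⟩
    suc (2 * (⟦ β ⟧ + 2 * interleave a₁ b₁))     ≡⟨ sym (interleave-bits I β a₁ b₁) ⟩
    interleave (suc (2 * a₁)) (⟦ β ⟧ + 2 * b₁)   ∎)
... | refl , refl = same
interleave-suc-acc {a} {b} {c} {d} (acc rec) eq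
  | I , a₁ , refl | O , b₁ , refl
  with interleave-injective {c} {d} {2 * a₁} {suc (2 * b₁)} (begin
    interleave c d                               ≡⟨ eq ⟩
    suc (interleave (suc (2 * a₁)) (2 * b₁))     ≡⟨ cong suc (interleave-bits I O a₁ b₁) ⟩
    2 + 2 * (2 * interleave a₁ b₁)               ≡⟨ sym (*-suc 2 (2 * interleave a₁ b₁)) ⟩
    2 * (1 + 2 * interleave a₁ b₁)               ≡⟨ sym (interleave-bits O I a₁ b₁) ⟩
    interleave (2 * a₁) (suc (2 * b₁))           ∎)
... | refl , refl = precedes (inj₁ (≤-reflexive (cong suc (+-suc (2 * a₁) (2 * b₁)))))
interleave-suc-acc {a} {b} {c} {d} (acc rec) eq
  | I , a₁ , refl | I , b₁ , refl with split-bit c | split-bit d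
... | γ , c₁ , refl | δ , d₁ , refl
  with bits-injective γ δ O O (interleave c₁ d₁) (suc (interleave a₁ b₁)) (begin
    ⟦ γ ⟧ + 2 * (⟦ δ ⟧ + 2 * interleave c₁ d₁)   ≡⟨ sym (interleave-bits γ δ c₁ d₁) ⟩
    interleave c d                               ≡⟨ eq ⟩
    suc (interleave a b)                         ≡⟨ cong suc (interleave-bits I I a₁ b₁) ⟩
    2 + 2 * (1 + 2 * interleave a₁ b₁)           ≡⟨ carry (interleave a₁ b₁) ⟩
    2 * (2 * suc (interleave a₁ b₁))             ∎)
  where
  carry : ∀ x → 2 + 2 * (1 + 2 * x) ≡ 2 * (2 * (1 + x))
  carry = solve-∀
... | refl , refl , eq₁ =
  precedes (subst (λ x → Precedes c d x b) (*-suc 2 a₁)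
    (sameOrPrecedes-suc (sameOrPrecedes-double O O
      (interleave-suc-acc {a₁} {b₁} {c₁} {d₁} (rec (s≤s (m≤n*m a₁ 2))) eq₁))))

interleave-suc : ∀ {a b c d} → interleave c d ≡ suc (interleave a b) → SameOrPrecedes c d (suc a) b
interleave-suc = interleave-suc-acc (<-wellFounded _)

interleave-2+ : ∀ {a b c d} → interleave c d ≡ 2 + interleave a b → SameOrPrecedes c d a (suc b)
interleave-2+ {a} {b} {c} {d} eq with split-bit a | split-bit b
... | α , a₁ , refl | O , b₁ , refl
  with interleave-injective {c} {d} {⟦ α ⟧ + 2 * a₁} {suc (2 * b₁)} (begin
    interleave c d                                ≡⟨ eq ⟩
    2 + interleave (⟦ α ⟧ + 2 * a₁) (2 * b₁)      ≡⟨ cong (2 +_) (interleave-bits α O a₁ b₁) ⟩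
    2 + (⟦ α ⟧ + 2 * (2 * interleave a₁ b₁))      ≡⟨ set-bit ⟦ α ⟧ (interleave a₁ b₁) ⟩
    ⟦ α ⟧ + 2 * (1 + 2 * interleave a₁ b₁)        ≡⟨ sym (interleave-bits α I a₁ b₁) ⟩
    interleave (⟦ α ⟧ + 2 * a₁) (suc (2 * b₁))    ∎)
  where
  set-bit : ∀ z x → 2 + (z + 2 * (2 * x)) ≡ z + 2 * (1 + 2 * x)
  set-bit = solve-∀
... | refl , refl = same
interleave-2+ {a} {b} {c} {d} eq
  | α , a₁ , refl | I , b₁ , refl with split-bit c | split-bit d
... | γ , c₁ , refl | δ , d₁ , refl
  with bits-injective γ δ α O (interleave c₁ d₁) (suc (interleave a₁ b₁)) (begin
    ⟦ γ ⟧ + 2 * (⟦ δ ⟧ + 2 * interleave c₁ d₁)   ≡⟨ sym (interleave-bits γ δ c₁ d₁) ⟩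
    interleave c d                               ≡⟨ eq ⟩
    2 + interleave a b                           ≡⟨ cong (2 +_) (interleave-bits α I a₁ b₁) ⟩
    2 + (⟦ α ⟧ + 2 * (1 + 2 * interleave a₁ b₁)) ≡⟨ carry ⟦ α ⟧ (interleave a₁ b₁) ⟩
    ⟦ α ⟧ + 2 * (2 * suc (interleave a₁ b₁))     ∎)
  where
  carry : ∀ z x → 2 + (z + 2 * (1 + 2 * x)) ≡ z + 2 * (2 * (1 + x))
  carry = solve-∀
... | refl , refl , eq₁ =
  precedes (subst (Precedes c d a) (*-suc 2 b₁)
    (precedes-double α O {c₁} {d₁} {a₁} {suc b₁}
      (sameOrPrecedes-diagonal (interleave-suc {a₁} {b₁} {c₁} {d₁} eq₁))))

record ShiftBound (Z u v : ℕ) : Set where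
  field
    shift-bound : ∀ a b c d → interleave c d ≡ Z + interleave a b →
                  SameOrPrecedes c d (u + a) (v + b)
open ShiftBound

shiftBound-scale : ∀ {Z u v} → ShiftBound Z u v → ShiftBound (4 * Z) (2 * u) (2 * v)
shift-bound (shiftBound-scale {Z} {u} {v} shift) a b c d eq
  with split-bit a | split-bit b | split-bit c | split-bit d
... | α , a₁ , refl | β , b₁ , refl | γ , c₁ , refl | δ , d₁ , refl
  with bits-injective γ δ α β (interleave c₁ d₁) (Z + interleave a₁ b₁) (begin
    ⟦ γ ⟧ + 2 * (⟦ δ ⟧ + 2 * interleave c₁ d₁)         ≡⟨ sym (interleave-bits γ δ c₁ d₁) ⟩
    interleave c d                                     ≡⟨ eq ⟩
    4 * Z + interleave a b                             ≡⟨ cong (4 * Z +_) (interleave-bits α β a₁ b₁) ⟩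
    4 * Z + (⟦ α ⟧ + 2 * (⟦ β ⟧ + 2 * interleave a₁ b₁)) ≡⟨ shift-digits Z ⟦ α ⟧ ⟦ β ⟧ (interleave a₁ b₁) ⟩
    ⟦ α ⟧ + 2 * (⟦ β ⟧ + 2 * (Z + interleave a₁ b₁))   ∎)
  where
  shift-digits : ∀ z x y n → 4 * z + (x + 2 * (y + 2 * n)) ≡ x + 2 * (y + 2 * (z + n))
  shift-digits = solve-∀
... | refl , refl , eq₁ =
  subst₂ (SameOrPrecedes c d) (rescale ⟦ α ⟧ u a₁) (rescale ⟦ β ⟧ v b₁)
    (sameOrPrecedes-double α β (shift-bound shift a₁ b₁ c₁ d₁ eq₁))
  where
  rescale : ∀ x w m → x + 2 * (w + m) ≡ 2 * w + (x + 2 * m)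
  rescale = solve-∀

shiftBound-square : ∀ k → let q = 2 ^ k in ShiftBound (q * q) q 0
shift-bound (shiftBound-square zero) a b c d = interleave-suc
shiftBound-square (suc k) =
  subst (λ Z → ShiftBound Z (2 ^ suc k) 0) (square-double (2 ^ k))
    (shiftBound-scale (shiftBound-square k))
  where
  square-double : ∀ q → 4 * (q * q) ≡ 2 * q * (2 * q)
  square-double = solve-∀

shiftBound-twiceSquare : ∀ k → let q = 2 ^ k in ShiftBound (2 * (q * q)) 0 q
shift-bound (shiftBound-twiceSquare zero) a b c d = interleave-2+
shiftBound-twiceSquare (suc k) =
  subst (λ Z → ShiftBound Z 0 (2 ^ suc k)) (square-double (2 ^ k))
    (shiftBound-scale (shiftBound-twiceSquare k))
  where
  square-double : ∀ q → 4 * (2 * (q * q)) ≡ 2 * (2 * q * (2 * q))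
  square-double = solve-∀

bracketExp-interleave : ∀ a b → bracketExp a b ≡ suc (2 * interleave a b)
bracketExp-interleave a b = rearrange (g a) (g b)
  where
  rearrange : ∀ x y → 1 + 2 * x + 4 * y ≡ suc (2 * (x + 2 * y))
  rearrange = solve-∀

bracket-shift : ∀ {Z u v} → ShiftBound Z u v → ∀ a b →
  (∃₂ λ c d → bracketExp c d ≡ 2 * Z + bracketExp a b)
  × (∀ c d → bracketExp c d ≡ 2 * Z + bracketExp a b → EqOrPrecedes c d (u + a) (v + b))
bracket-shift {Z} {u} {v} shift a b = reached , bounded
  where
  target : 2 * Z + bracketExp a b ≡ suc (2 * (Z + interleave a b))
  target = trans (cong (2 * Z +_) (bracketExp-interleave a b)) (rearrange Z (interleave a b))
    where
    rearrange : ∀ z n → 2 * z + suc (2 * n) ≡ suc (2 * (z + n))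
    rearrange = solve-∀

  reached : ∃₂ λ c d → bracketExp c d ≡ 2 * Z + bracketExp a b
  reached with interleave-surjective (Z + interleave a b)
  ... | c , d , eq =
    c , d , trans (bracketExp-interleave c d) (trans (cong (λ n → suc (2 * n)) eq) (sym target))

  bounded : ∀ c d → bracketExp c d ≡ 2 * Z + bracketExp a b → EqOrPrecedes c d (u + a) (v + b)
  bounded c d eq with shift-bound shift a b c d
    (*-cancelˡ-≡ _ _ 2 (suc-injective (trans (sym (bracketExp-interleave c d)) (trans eq target))))
  ... | same       = inj₁ refl
  ... | precedes p = inj₂ p

4*n≡2*[2*n] : ∀ n → 4 * n ≡ 2 * (2 * n)
4*n≡2*[2*n] = solve-∀

corollary2p8 : (k a b : ℕ) →
  let q = 2 ^ k in
  ((∃₂ λ c d → bracketExp c d ≡ 2 * (q * q) + bracketExp a b)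
    × (∀ c d → bracketExp c d ≡ 2 * (q * q) + bracketExp a b → EqOrPrecedes c d (a + q) b))
  × ((∃₂ λ c d → bracketExp c d ≡ 4 * (q * q) + bracketExp a b)
    × (∀ c d → bracketExp c d ≡ 4 * (q * q) + bracketExp a b → EqOrPrecedes c d a (b + q)))
corollary2p8 k a b
  rewrite +-comm a (2 ^ k) | +-comm b (2 ^ k) | 4*n≡2*[2*n] (2 ^ k * 2 ^ k) =
  bracket-shift (shiftBound-square k) a b , bracket-shift (shiftBound-twiceSquare k) a b
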